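{- Let $\Gamma$ be a simple strongly connected digraph with vertex set $X$ and diameter $D$. Then $\Gamma$ is a distance-regular digraph if and only if, for all $x,y\in X$ with $y\in\Gamma^{\rightarrow}_h(x)$ $(0\le h\le D)$, the numbers $s^h_{i1}:=|\Gamma^{\rightarrow}_i(x)\cap\Gamma^{\rightarrow}_1(y)|$ $(0\le i\le D)$ do not depend on the choice of $x$ and $y$ but only on $h$ (and $i$).
   Context: $\partial(x,y)$ is the directed distance; $\Gamma^{\rightarrow}_i(x)=\{z\mid\partial(x,z)=i\}$, $\Gamma^{\leftarrow}_i(x)=\{z\mid\partial(z,x)=i\}$. $\Gamma$ is a distance-regular digraph if there are integers $d^{\rightarrow}_{ij},d^{\leftarrow}_{ij}$ $(0\le i,j\le D)$ such that for every $x\in X$ and every $y\in\Gamma^{\rightarrow}_i(x)$: $|\Gamma^{\rightarrow}_1(y)\cap\Gamma^{\rightarrow}_j(x)|=d^{\rightarrow}_{ij}$ and $|\Gamma^{\leftarrow}_1(y)\cap\Gamma^{\rightarrow}_j(x)|=d^{\leftarrow}_{ij}$. -}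

module Defs where

open import Data.Nat using (ℕ; zero; suc; _≤_)
open import Data.Fin using (Fin; _≟_)
open import Data.Bool using (Bool; true; false; _∧_; _∨_; not; if_then_else_)
open import Data.List using (List; foldr; map)
open import Data.List using (sum)
open import Data.Fin.Base using ()
open import Data.List.Base using ()
open import Data.Vec.Functional using ()
open import Data.Product using (Σ; _×_; ∃; ∃-syntax)
open import Relation.Nullary.Decidable using (⌊_⌋)
open import Relation.Binary.PropositionalEquality using (_≡_)
import Data.List as L
import Data.Fin as F
import Data.Bool.ListAction as BL

-- A finite digraph on vertex set Fin n, arcs given by a Boolean relation
-- (so there are no multiple arcs).  Simple = additionally no loops.
record Digraph : Set where
  field
    n   : ℕ
    arc : Fin n → Fin n → Bool

open Digraph public

Vertex : Digraph → Set
Vertex Γ = Fin (n Γ)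

Simple : Digraph → Set
Simple Γ = ∀ (x : Vertex Γ) → arc Γ x x ≡ false

vertices : (Γ : Digraph) → List (Vertex Γ)
vertices Γ = L.allFin (n Γ)

anyV : (Γ : Digraph) → (Vertex Γ → Bool) → Bool
anyV Γ p = BL.any p (vertices Γ)

walk : (Γ : Digraph) → ℕ → Vertex Γ → Vertex Γ → Bool
walk Γ zero    x y = ⌊ x ≟ y ⌋
walk Γ (suc k) x y = anyV Γ (λ z → arc Γ x z ∧ walk Γ k z y)

within : (Γ : Digraph) → ℕ → Vertex Γ → Vertex Γ → Bool
within Γ zero    x y = walk Γ zero x y
within Γ (suc k) x y = within Γ k x y ∨ walk Γ (suc k) x y

isDist : (Γ : Digraph) → Vertex Γ → Vertex Γ → ℕ → Bool
isDist Γ x y zero    = within Γ zero x y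
isDist Γ x y (suc i) = within Γ (suc i) x y ∧ not (within Γ i x y)

count : (Γ : Digraph) → (Vertex Γ → Bool) → ℕ
count Γ p = L.length (L.filterᵇ p (vertices Γ))

outSph : (Γ : Digraph) → ℕ → Vertex Γ → Vertex Γ → Bool
outSph Γ i x z = isDist Γ x z i

inSph : (Γ : Digraph) → ℕ → Vertex Γ → Vertex Γ → Bool
inSph Γ i x z = isDist Γ z x i

StronglyConnected : Digraph → Set
StronglyConnected Γ = ∀ (x y : Vertex Γ) → ∃[ k ] walk Γ k x y ≡ true

Diameter : (Γ : Digraph) → ℕ → Set
Diameter Γ D =
  (∀ (x y : Vertex Γ) → within Γ D x y ≡ true)
  × (∃[ x ] ∃[ y ] isDist Γ x y D ≡ true)

DistanceRegular : (Γ : Digraph) → ℕ → Set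
DistanceRegular Γ D =
  Σ (ℕ → ℕ → ℕ) λ d→ → Σ (ℕ → ℕ → ℕ) λ d← →
    (∀ (i j : ℕ) → i ≤ D → j ≤ D → ∀ (x y : Vertex Γ) → outSph Γ i x y ≡ true →
       (count Γ (λ z → outSph Γ 1 y z ∧ outSph Γ j x z) ≡ d→ i j)
       × (count Γ (λ z → inSph Γ 1 y z ∧ outSph Γ j x z) ≡ d← i j))

IntersectionNumbersWellDefined : (Γ : Digraph) → ℕ → Set
IntersectionNumbersWellDefined Γ D =
  Σ (ℕ → ℕ → ℕ) λ s → (∀ (h i : ℕ) → h ≤ D → i ≤ D → ∀ (x y : Vertex Γ) → outSph Γ h x y ≡ true →
            count Γ (λ z → outSph Γ i x z ∧ outSph Γ 1 y z) ≡ s h i)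

{-# OPTIONS --safe #-}
module Submission where

-- Call a vertex-indexed matrix radial if its (x, y) entry depends only on ∂(x, y), and let 𝔸 h be the
-- distance-h matrix, so that a radial F equals ∑ₕ f(h) 𝔸 h.  The hypothesis says that 𝔸 i Aᵀ is radial
-- for every i (A the adjacency matrix), so F ↦ F Aᵀ preserves radial matrices and, starting from 𝔸 0 = I,
-- the reversed walk counts (Aᵀ)ˡ are radial.  Since ∂(y, x) is the least l admitting a walk of length l
-- from y to x, it is a function of ∂(x, y); hence transposes of radial matrices are radial, and so is Aˡ.
-- As Aˡ(y, z) vanishes for l < ∂(y, z) and is positive for l = ∂(y, z), the Aˡ are triangular over the
-- 𝔸 h, and solving the triangular system shows that every 𝔸 j 𝔸 mᵀ is radial.  Finally
-- |Γ←₁(y) ∩ Γ→ⱼ(x)| is the (x, y) entry of 𝔸 j (𝔸 1ᵀ)ᵀ, a combination of these, because 𝔸 1ᵀ is radial.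

open import Defs
open import Data.Bool using (Bool; true; false; _∧_; _∨_; not)
open import Data.Bool.Properties using (∧-comm; ∧-identityʳ; ∨-zeroʳ)
import Data.Bool.ListAction as BL
open import Data.Empty using (⊥-elim)
open import Data.Fin using (Fin; zero; suc; toℕ; fromℕ<; punchIn; _≟_)
open import Data.Fin.Properties using (toℕ-fromℕ<; toℕ-injective; toℕ≤pred[n]; punchInᵢ≢i)
import Data.List as L
open import Data.List.Properties using (map-cong)
open import Data.Nat using (ℕ; zero; suc; _+_; _*_; _∸_; _/_; _≤_; _<_; _≤?_; _<?_; z≤n; s≤s; s≤s⁻¹)
open import Data.Nat.Properties
  using (+-identityʳ; *-comm; *-assoc; *-zeroʳ; m+n∸n≡m; ≤-refl; ≤-antisym; <-irrefl;
         ≰⇒>; <⇒≱; n≤0⇒n≡0; <-cmp; +-*-semiring; *-commutativeSemigroup)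
  renaming (_≟_ to _≟ℕ_)
open import Data.Nat.DivMod using (m*n/n≡m)
open import Data.Nat.Induction using (<-rec)
open import Data.Product using (Σ; ∃-syntax; _×_; _,_; proj₁; proj₂)
open import Function using (_∘_; id; _⇔_; mk⇔)
open import Relation.Binary.Definitions using (tri<; tri≈; tri>)
open import Relation.Binary.PropositionalEquality
open import Relation.Nullary using (Dec; yes; no; does; ¬_; ¬?; _×-dec_)
open import Relation.Nullary.Decidable using (isYes≗does; dec-true; dec-false; does-⇔)
open import Algebra.Properties.Semiring.Sum +-*-semiring
  using (sum; sum-syntax; sum-cong-≗; sum-remove; sum-replicate-zero; ∑-comm; *-distribˡ-sum; *-distribʳ-sum)
open import Algebra.Properties.CommutativeSemigroup *-commutativeSemigroup using (x∙yz≈y∙xz; x∙yz≈xz∙y)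

χ : Bool → ℕ
χ true  = 1
χ false = 0

χ-∧ : ∀ a b → χ (a ∧ b) ≡ χ a * χ b
χ-∧ true  b = sym (+-identityʳ (χ b))
χ-∧ false b = refl

0<χ : ∀ b → does (0 <? χ b) ≡ b
0<χ true  = refl
0<χ false = refl

0<χ* : ∀ b m → does (0 <? χ b * m) ≡ b ∧ does (0 <? m)
0<χ* true  m = cong (λ k → does (0 <? k)) (+-identityʳ m)
0<χ* false m = refl

0<+ : ∀ a b → does (0 <? a + b) ≡ does (0 <? a) ∨ does (0 <? b)
0<+ zero    b = refl
0<+ (suc a) b = refl

does-true⇒ : {A : Set} (a? : Dec A) → does a? ≡ true → A
does-true⇒ (yes a) _ = a

≤suc∧≰⇔≡suc : ∀ {m k} → (m ≤ suc k × ¬ m ≤ k) ⇔ m ≡ suc k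
≤suc∧≰⇔≡suc = mk⇔ (λ (m≤1+k , m≰k) → ≤-antisym m≤1+k (≰⇒> m≰k))
                   (λ { refl → ≤-refl , <-irrefl refl })

≟-sym : ∀ {n} (i j : Fin n) → does (i ≟ j) ≡ does (j ≟ i)
≟-sym i j = does-⇔ (mk⇔ sym sym) (i ≟ j) (j ≟ i)

∑-single : ∀ {k} (t : Fin k → ℕ) (i : Fin k) → (∀ j → j ≢ i → t j ≡ 0) → ∑[ j < k ] t j ≡ t i
∑-single {suc k} t i others = begin
  sum t
    ≡⟨ sum-remove t ⟩
  t i + ∑[ j < k ] t (punchIn i j)
    ≡⟨ cong (t i +_) (trans (sum-cong-≗ (λ j → others _ (punchInᵢ≢i i j))) (sum-replicate-zero k)) ⟩
  t i + 0
    ≡⟨ +-identityʳ (t i) ⟩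
  t i
    ∎
  where open ≡-Reasoning

∑-δ : ∀ {k} (i : Fin k) (f : Fin k → ℕ) → ∑[ j < k ] (f j * χ (does (j ≟ i))) ≡ f i
∑-δ i f = trans (∑-single _ i others) on-diagonal
  where
  others : ∀ j → j ≢ i → f j * χ (does (j ≟ i)) ≡ 0
  others j j≢i rewrite dec-false (j ≟ i) j≢i = *-zeroʳ (f j)
  on-diagonal : f i * χ (does (i ≟ i)) ≡ f i
  on-diagonal rewrite dec-true (i ≟ i) refl = trans (*-comm (f i) 1) (+-identityʳ (f i))

∑-δ-toℕ : ∀ {k} h → h < k → (f : ℕ → ℕ) → ∑[ m < k ] (f (toℕ m) * χ (does (h ≟ℕ toℕ m))) ≡ f h
∑-δ-toℕ h h<k f = trans (∑-single _ (fromℕ< h<k) others) on-diagonal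
  where
  h≢toℕ : ∀ m → m ≢ fromℕ< h<k → h ≢ toℕ m
  h≢toℕ m m≢h h≡m = m≢h (toℕ-injective (trans (sym h≡m) (sym (toℕ-fromℕ< h<k))))
  others : ∀ m → m ≢ fromℕ< h<k → f (toℕ m) * χ (does (h ≟ℕ toℕ m)) ≡ 0
  others m m≢h rewrite dec-false (h ≟ℕ toℕ m) (h≢toℕ m m≢h) = *-zeroʳ (f (toℕ m))
  on-diagonal : f (toℕ (fromℕ< h<k)) * χ (does (h ≟ℕ toℕ (fromℕ< h<k))) ≡ f h
  on-diagonal rewrite toℕ-fromℕ< h<k | dec-true (h ≟ℕ h) refl = trans (*-comm (f h) 1) (+-identityʳ (f h))

∑-∑-*ˡ : ∀ {k N} (c : Fin N → ℕ) (T : Fin k → Fin N → ℕ) →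
         ∑[ z < k ] ∑[ m < N ] (c m * T z m) ≡ ∑[ m < N ] (c m * ∑[ z < k ] T z m)
∑-∑-*ˡ c T = trans (∑-comm (λ z m → c m * T z m))
                   (sum-cong-≗ (λ m → sym (*-distribˡ-sum (c m) (λ z → T z m))))

0<∑≡any : ∀ {A : Set} {k} (f : A → ℕ) (g : Fin k → A) →
          does (0 <? ∑[ i < k ] f (g i)) ≡ BL.any (λ a → does (0 <? f a)) (L.tabulate g)
0<∑≡any {k = zero}  f g = refl
0<∑≡any {k = suc k} f g =
  trans (0<+ (f (g zero)) _) (cong (does (0 <? f (g zero)) ∨_) (0<∑≡any f (g ∘ suc)))

∑-χ-< : ∀ {D} h → h ≤ D → ∑[ l < D ] χ (does (toℕ l <? h)) ≡ h
∑-χ-< {zero}  zero    _       = refl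
∑-χ-< {suc D} zero    _       = ∑-χ-< {D} zero z≤n
∑-χ-< {suc D} (suc h) (s≤s h≤D) = cong suc (∑-χ-< h h≤D)

upward-closed : (p : ℕ → Bool) → (∀ {l} → p l ≡ true → p (suc l) ≡ true) →
                p 0 ≡ true → ∀ l → p l ≡ true
upward-closed p mono p0 zero    = p0
upward-closed p mono p0 (suc l) = mono (upward-closed p mono p0 l)

threshold : (p : ℕ → Bool) → (∀ {l} → p l ≡ true → p (suc l) ≡ true) →
            ∀ {K} → p K ≡ true → ∃[ k ] (∀ l → p l ≡ does (k ≤? l))
threshold p mono {zero}  pK = 0 , upward-closed p mono pK
threshold p mono {suc K} pK with p 0 in p0
... | true  = 0 , upward-closed p mono p0
... | false with threshold (p ∘ suc) mono pK
...   | k , p∘suc≡ = suc k , λ where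
        zero    → p0
        (suc l) → trans (p∘suc≡ l) (does-⇔ (mk⇔ s≤s s≤s⁻¹) (k ≤? l) (suc k ≤? suc l))

Mat : ℕ → Set
Mat n = Fin n → Fin n → ℕ

𝟙 : ∀ {n} → Mat n
𝟙 x y = χ (does (x ≟ y))

_·_ : ∀ {n} → Mat n → Mat n → Mat n
_·_ {n} M N x y = ∑[ u < n ] (M x u * N u y)

_·ᵀ_ : ∀ {n} → Mat n → Mat n → Mat n
_·ᵀ_ {n} F G x y = ∑[ z < n ] (F x z * G y z)

_^_ : ∀ {n} → Mat n → ℕ → Mat n
M ^ zero  = 𝟙
M ^ suc l = M · (M ^ l)

·-identityʳ : ∀ {n} (M : Mat n) x y → (M · 𝟙) x y ≡ M x y
·-identityʳ M x y = ∑-δ y (M x)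

·ᵀ-identityʳ : ∀ {n} (F : Mat n) x y → (F ·ᵀ 𝟙) x y ≡ F x y
·ᵀ-identityʳ F x y =
  trans (sum-cong-≗ (λ z → cong (λ b → F x z * χ b) (≟-sym y z))) (∑-δ y (F x))

·ᵀ-identityˡ : ∀ {n} (G : Mat n) x y → (𝟙 ·ᵀ G) x y ≡ G y x
·ᵀ-identityˡ G x y = trans (sum-cong-≗ swap) (∑-δ x (G y))
  where
  swap : ∀ z → 𝟙 x z * G y z ≡ G y z * χ (does (z ≟ x))
  swap z = trans (*-comm (𝟙 x z) (G y z)) (cong (λ b → G y z * χ b) (≟-sym x z))

·ᵀ-·-assoc : ∀ {n} (F M G : Mat n) x y → (F ·ᵀ (M · G)) x y ≡ ((F ·ᵀ G) ·ᵀ M) x y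
·ᵀ-·-assoc {n} F M G x y = begin
  ∑[ z < n ] (F x z * ∑[ u < n ] (M y u * G u z))
    ≡⟨ sum-cong-≗ (λ z → *-distribˡ-sum (F x z) (λ u → M y u * G u z)) ⟩
  ∑[ z < n ] ∑[ u < n ] (F x z * (M y u * G u z))
    ≡⟨ ∑-comm (λ z u → F x z * (M y u * G u z)) ⟩
  ∑[ u < n ] ∑[ z < n ] (F x z * (M y u * G u z))
    ≡⟨ sum-cong-≗ (λ u → trans (sum-cong-≗ (λ z → x∙yz≈xz∙y (F x z) (M y u) (G u z)))
                               (sym (*-distribʳ-sum (M y u) (λ z → F x z * G u z)))) ⟩
  ∑[ u < n ] (∑[ z < n ] (F x z * G u z) * M y u)
    ∎
  where open ≡-Reasoning

module RadialMatrices {n : ℕ} (D : ℕ) (∂ : Fin n → Fin n → ℕ) (∂≤D : ∀ x y → ∂ x y ≤ D) where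

  𝔸 : ℕ → Mat n
  𝔸 m x y = χ (does (∂ x y ≟ℕ m))

  Radial : {A : Set} → (Fin n → Fin n → A) → Set
  Radial {A} F = Σ (ℕ → A) λ f → ∀ x y → F x y ≡ f (∂ x y)

  radial-cong : ∀ {A} {F G : Fin n → Fin n → A} →
                (∀ x y → F x y ≡ G x y) → Radial G → Radial F
  radial-cong F≡G (g , hg) = g , λ x y → trans (F≡G x y) (hg x y)

  radial-map : ∀ {A B} {F : Fin n → Fin n → A} (h : A → B) →
               Radial F → Radial (λ x y → h (F x y))
  radial-map h (f , hf) = h ∘ f , λ x y → cong h (hf x y)

  radial-zipWith : ∀ {A B C} {F : Fin n → Fin n → A} {G : Fin n → Fin n → B} (_⊕_ : A → B → C) →
                   Radial F → Radial G → Radial (λ x y → F x y ⊕ G x y)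
  radial-zipWith _⊕_ (f , hf) (g , hg) = (λ h → f h ⊕ g h) , λ x y → cong₂ _⊕_ (hf x y) (hg x y)

  radial-transpose : Radial (λ x y → ∂ y x) →
                     ∀ {A} {F : Fin n → Fin n → A} → Radial F → Radial (λ x y → F y x)
  radial-transpose (σ , hσ) (f , hf) = f ∘ σ , λ x y → trans (hf y x) (cong f (hσ x y))

  radial-𝔸 : ∀ m → Radial (𝔸 m)
  radial-𝔸 m = (λ h → χ (does (h ≟ℕ m))) , λ _ _ → refl

  radial-∑ : ∀ {k} (T : Fin k → Mat n) → (∀ j → Radial (T j)) → Radial (λ x y → ∑[ j < k ] T j x y)
  radial-∑ {k} T rad =
    (λ h → ∑[ j < k ] proj₁ (rad j) h) , λ x y → sum-cong-≗ (λ j → proj₂ (rad j) x y)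

  radial-cancel : ∀ {F : Mat n} c → (c ≡ 0 → ∀ x y → F x y ≡ 0) →
                  Radial (λ x y → c * F x y) → Radial F
  radial-cancel zero    F≡0 _        = (λ _ → 0) , F≡0 refl
  radial-cancel {F} (suc c) _ (g , hg) = (λ h → g h / suc c) , λ x y →
    trans (sym (m*n/n≡m (F x y) (suc c))) (cong (_/ suc c) (trans (*-comm (F x y) (suc c)) (hg x y)))

  radial-expansion : ∀ (f : ℕ → ℕ) x y → f (∂ x y) ≡ ∑[ m < suc D ] (f (toℕ m) * 𝔸 (toℕ m) x y)
  radial-expansion f x y = sym (∑-δ-toℕ (∂ x y) (s≤s (∂≤D x y)) f)

  ·ᵀ-expandˡ : ∀ {F} (G : Mat n) (f : ℕ → ℕ) → (∀ x y → F x y ≡ f (∂ x y)) →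
               ∀ x y → (F ·ᵀ G) x y ≡ ∑[ m < suc D ] (f (toℕ m) * (𝔸 (toℕ m) ·ᵀ G) x y)
  ·ᵀ-expandˡ {F} G f hf x y = begin
    ∑[ z < n ] (F x z * G y z)
      ≡⟨ sum-cong-≗ (λ z → cong (_* G y z) (trans (hf x z) (radial-expansion f x z))) ⟩
    ∑[ z < n ] (∑[ m < suc D ] (f (toℕ m) * 𝔸 (toℕ m) x z) * G y z)
      ≡⟨ sum-cong-≗ (λ z → trans (*-distribʳ-sum {suc D} (G y z) (λ m → f (toℕ m) * 𝔸 (toℕ m) x z))
                                 (sum-cong-≗ {suc D} (λ m → *-assoc (f (toℕ m)) (𝔸 (toℕ m) x z) (G y z)))) ⟩
    ∑[ z < n ] ∑[ m < suc D ] (f (toℕ m) * (𝔸 (toℕ m) x z * G y z))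
      ≡⟨ ∑-∑-*ˡ {n} {suc D} (f ∘ toℕ) (λ z m → 𝔸 (toℕ m) x z * G y z) ⟩
    ∑[ m < suc D ] (f (toℕ m) * (𝔸 (toℕ m) ·ᵀ G) x y)
      ∎
    where open ≡-Reasoning

  ·ᵀ-expandʳ : ∀ {G} (F : Mat n) (g : ℕ → ℕ) → (∀ x y → G x y ≡ g (∂ x y)) →
               ∀ x y → (F ·ᵀ G) x y ≡ ∑[ m < suc D ] (g (toℕ m) * (F ·ᵀ 𝔸 (toℕ m)) x y)
  ·ᵀ-expandʳ {G} F g hg x y = begin
    ∑[ z < n ] (F x z * G y z)
      ≡⟨ sum-cong-≗ (λ z → cong (F x z *_) (trans (hg y z) (radial-expansion g y z))) ⟩
    ∑[ z < n ] (F x z * ∑[ m < suc D ] (g (toℕ m) * 𝔸 (toℕ m) y z))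
      ≡⟨ sum-cong-≗ (λ z → trans (*-distribˡ-sum {suc D} (F x z) (λ m → g (toℕ m) * 𝔸 (toℕ m) y z))
                                 (sum-cong-≗ {suc D} (λ m → x∙yz≈y∙xz (F x z) (g (toℕ m)) (𝔸 (toℕ m) y z)))) ⟩
    ∑[ z < n ] ∑[ m < suc D ] (g (toℕ m) * (F x z * 𝔸 (toℕ m) y z))
      ≡⟨ ∑-∑-*ˡ {n} {suc D} (g ∘ toℕ) (λ z m → F x z * 𝔸 (toℕ m) y z) ⟩
    ∑[ m < suc D ] (g (toℕ m) * (F ·ᵀ 𝔸 (toℕ m)) x y)
      ∎
    where open ≡-Reasoning

  radial-·ᵀˡ : ∀ {F} (G : Mat n) → Radial F →
               (∀ (m : Fin (suc D)) → Radial (𝔸 (toℕ m) ·ᵀ G)) → Radial (F ·ᵀ G)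
  radial-·ᵀˡ G (f , hf) rad =
    radial-cong (·ᵀ-expandˡ G f hf) (radial-∑ _ (λ m → radial-map (f (toℕ m) *_) (rad m)))

  radial-·ᵀʳ : ∀ {G} (F : Mat n) → Radial G →
               (∀ (m : Fin (suc D)) → Radial (F ·ᵀ 𝔸 (toℕ m))) → Radial (F ·ᵀ G)
  radial-·ᵀʳ F (g , hg) rad =
    radial-cong (·ᵀ-expandʳ F g hg) (radial-∑ _ (λ m → radial-map (g (toℕ m) *_) (rad m)))

  radial-·ᵀ^ : ∀ (M : Mat n) → (∀ (m : Fin (suc D)) → Radial (𝔸 (toℕ m) ·ᵀ M)) →
               ∀ {F} → Radial F → ∀ l → Radial (F ·ᵀ (M ^ l))
  radial-·ᵀ^ M rad {F} F-radial zero    = radial-cong (·ᵀ-identityʳ F) F-radial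
  radial-·ᵀ^ M rad {F} F-radial (suc l) =
    radial-cong (·ᵀ-·-assoc F M (M ^ l)) (radial-·ᵀˡ M (radial-·ᵀ^ M rad F-radial l) rad)

  ·ᵀ𝔸-empty : ∀ (F : Mat n) m x y → (∀ z → ∂ y z ≢ m) → (F ·ᵀ 𝔸 m) x y ≡ 0
  ·ᵀ𝔸-empty F m x y empty = trans (sum-cong-≗ vanish) (sum-replicate-zero n)
    where
    vanish : ∀ z → F x z * 𝔸 m y z ≡ 0
    vanish z rewrite dec-false (∂ y z ≟ℕ m) (empty z) = *-zeroʳ (F x z)

  module TriangularBasis (G : ℕ → Mat n) (radial-G : ∀ l → Radial (G l))
                         (G-below-∂ : ∀ l y z → l < ∂ y z → G l y z ≡ 0)
                         (G-at-∂ : ∀ y z → 0 < G (∂ y z) y z)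
                         (F : Mat n) (radial-F·ᵀG : ∀ l → Radial (F ·ᵀ G l)) where

    c : ℕ → ℕ → ℕ
    c l = proj₁ (radial-G l)

    c-below-∂ : ∀ l y z → l < ∂ y z → c l (∂ y z) ≡ 0
    c-below-∂ l y z l<∂ = trans (sym (proj₂ (radial-G l) y z)) (G-below-∂ l y z l<∂)

    c-at-∂ : ∀ y z → 0 < c (∂ y z) (∂ y z)
    c-at-∂ y z = subst (0 <_) (proj₂ (radial-G (∂ y z)) y z) (G-at-∂ y z)

    c-above : ∀ {l m} x y → l < m → c l m * (F ·ᵀ 𝔸 m) x y ≡ 0
    c-above {l} {m} x y l<m with c l m ≟ℕ 0
    ... | yes c≡0 = cong (_* (F ·ᵀ 𝔸 m) x y) c≡0
    ... | no c≢0  = trans (cong (c l m *_) (·ᵀ𝔸-empty F m x y empty)) (*-zeroʳ (c l m))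
      where
      empty : ∀ z → ∂ y z ≢ m
      empty z refl = c≢0 (c-below-∂ l y z l<m)

    c-diagonal : ∀ l → c l l ≡ 0 → ∀ x y → (F ·ᵀ 𝔸 l) x y ≡ 0
    c-diagonal l c≡0 x y = ·ᵀ𝔸-empty F l x y λ { z refl → <-irrefl (sym c≡0) (c-at-∂ y z) }

    radial-F·ᵀ𝔸 : ∀ l → l ≤ D → Radial (F ·ᵀ 𝔸 l)
    radial-F·ᵀ𝔸 = <-rec _ step
      where
      -- Expanding F ·ᵀ G l along the 𝔸 m isolates c l l * (F ·ᵀ 𝔸 l): the terms with m < l are
      -- radial by induction and those with m > l vanish; c l l is 0 only if no pair has distance l.
      step : ∀ l → (∀ {m} → m < l → m ≤ D → Radial (F ·ᵀ 𝔸 m)) → l ≤ D → Radial (F ·ᵀ 𝔸 l)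
      step l below l≤D = radial-cancel (c l l) (c-diagonal l)
                           (radial-cong isolate (radial-zipWith _∸_ (radial-F·ᵀG l) (radial-∑ _ others)))
        where
        i : Fin (suc D)
        i = fromℕ< (s≤s l≤D)
        term : Fin (suc D) → Mat n
        term m x y = c l (toℕ m) * (F ·ᵀ 𝔸 (toℕ m)) x y
        isolate : ∀ x y → c l l * (F ·ᵀ 𝔸 l) x y ≡ (F ·ᵀ G l) x y ∸ ∑[ j < D ] term (punchIn i j) x y
        isolate x y = sym (begin
          (F ·ᵀ G l) x y ∸ rest
            ≡⟨ cong (_∸ rest) (trans (·ᵀ-expandʳ F (c l) (proj₂ (radial-G l)) x y)
                                     (sum-remove (λ m → term m x y))) ⟩
          (term i x y + rest) ∸ rest
            ≡⟨ m+n∸n≡m (term i x y) rest ⟩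
          term i x y
            ≡⟨ cong (λ m → c l m * (F ·ᵀ 𝔸 m) x y) (toℕ-fromℕ< (s≤s l≤D)) ⟩
          c l l * (F ·ᵀ 𝔸 l) x y
            ∎)
          where
          open ≡-Reasoning
          rest = ∑[ j < D ] term (punchIn i j) x y
        others : ∀ j → Radial (term (punchIn i j))
        others j with <-cmp (toℕ (punchIn i j)) l
        ... | tri< m<l _ _ = radial-map (c l _ *_) (below m<l (toℕ≤pred[n] (punchIn i j)))
        ... | tri≈ _ m≡l _ = ⊥-elim (punchInᵢ≢i i j (toℕ-injective (trans m≡l (sym (toℕ-fromℕ< (s≤s l≤D))))))
        ... | tri> _ _ l<m = (λ _ → 0) , λ x y → c-above x y l<m

length-filterᵇ-tabulate : ∀ {A : Set} {k} (p : A → Bool) (f : Fin k → A) →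
                          L.length (L.filterᵇ p (L.tabulate f)) ≡ ∑[ i < k ] χ (p (f i))
length-filterᵇ-tabulate {k = zero}  p f = refl
length-filterᵇ-tabulate {k = suc k} p f with p (f zero)
... | true  = cong suc (length-filterᵇ-tabulate p (f ∘ suc))
... | false = length-filterᵇ-tabulate p (f ∘ suc)

count≡∑ : ∀ Γ (p : Vertex Γ → Bool) → count Γ p ≡ ∑[ z < n Γ ] χ (p z)
count≡∑ Γ p = length-filterᵇ-tabulate p id

count-∧ : ∀ Γ (p q : Vertex Γ → Bool) →
          count Γ (λ z → p z ∧ q z) ≡ ∑[ z < n Γ ] (χ (p z) * χ (q z))
count-∧ Γ p q = trans (count≡∑ Γ (λ z → p z ∧ q z)) (sum-cong-≗ (λ z → χ-∧ (p z) (q z)))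

count-∧-comm : ∀ Γ (p q : Vertex Γ → Bool) →
               count Γ (λ z → p z ∧ q z) ≡ count Γ (λ z → q z ∧ p z)
count-∧-comm Γ p q = trans (count≡∑ Γ (λ z → p z ∧ q z))
  (trans (sum-cong-≗ (λ z → cong χ (∧-comm (p z) (q z)))) (sym (count≡∑ Γ (λ z → q z ∧ p z))))

module Walks (Γ : Digraph) where

  Adj : Mat (n Γ)
  Adj x y = χ (arc Γ x y)

  walk≡0<Adj^ : ∀ l x y → walk Γ l x y ≡ does (0 <? (Adj ^ l) x y)
  walk≡0<Adj^ zero    x y = trans (isYes≗does (x ≟ y)) (sym (0<χ _))
  walk≡0<Adj^ (suc l) x y = begin
    BL.any (λ z → arc Γ x z ∧ walk Γ l z y) (L.allFin (n Γ))
      ≡⟨ cong BL.or (map-cong step (L.allFin (n Γ))) ⟩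
    BL.any (λ z → does (0 <? Adj x z * (Adj ^ l) z y)) (L.allFin (n Γ))
      ≡⟨ sym (0<∑≡any (λ z → Adj x z * (Adj ^ l) z y) id) ⟩
    does (0 <? (Adj ^ suc l) x y)
      ∎
    where
    open ≡-Reasoning
    step : ∀ z → arc Γ x z ∧ walk Γ l z y ≡ does (0 <? Adj x z * (Adj ^ l) z y)
    step z = trans (cong (arc Γ x z ∧_) (walk≡0<Adj^ l z y)) (sym (0<χ* (arc Γ x z) _))

  walk-1≡arc : ∀ x y → walk Γ 1 x y ≡ arc Γ x y
  walk-1≡arc x y = trans (walk≡0<Adj^ 1 x y)
                         (trans (cong (λ m → does (0 <? m)) (·-identityʳ Adj x y)) (0<χ (arc Γ x y)))

  within-suc : ∀ x y {l} → within Γ l x y ≡ true → within Γ (suc l) x y ≡ true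
  within-suc x y w rewrite w = refl

  walk⇒within : ∀ l x y → walk Γ l x y ≡ true → within Γ l x y ≡ true
  walk⇒within zero    x y w = w
  walk⇒within (suc l) x y w rewrite w = ∨-zeroʳ (within Γ l x y)

  isDist⇒walk : ∀ i x y → isDist Γ x y i ≡ true → walk Γ i x y ≡ true
  isDist⇒walk zero    x y d = d
  isDist⇒walk (suc i) x y d with within Γ i x y
  ... | false = trans (sym (∧-identityʳ _)) d
  isDist⇒walk (suc i) x y () | true

  isDist-1≡arc : Simple Γ → ∀ x y → isDist Γ x y 1 ≡ arc Γ x y
  isDist-1≡arc simple x y with x ≟ y
  ... | yes refl = sym (simple x)
  ... | no _     = trans (∧-identityʳ _) (walk-1≡arc x y)

module Distance (Γ : Digraph) (D : ℕ) (reach : ∀ x y → within Γ D x y ≡ true) where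
  open Walks Γ

  distance-threshold : ∀ x y → ∃[ k ] (∀ l → within Γ l x y ≡ does (k ≤? l))
  distance-threshold x y =
    threshold (λ l → within Γ l x y) (λ {l} → within-suc x y {l}) {D} (reach x y)

  ∂ : Vertex Γ → Vertex Γ → ℕ
  ∂ x y = proj₁ (distance-threshold x y)

  within≡∂≤ : ∀ l x y → within Γ l x y ≡ does (∂ x y ≤? l)
  within≡∂≤ l x y = proj₂ (distance-threshold x y) l

  ∂≤D : ∀ x y → ∂ x y ≤ D
  ∂≤D x y = does-true⇒ (∂ x y ≤? D) (trans (sym (within≡∂≤ D x y)) (reach x y))

  isDist≡∂≟ : ∀ i x y → isDist Γ x y i ≡ does (∂ x y ≟ℕ i)
  isDist≡∂≟ zero    x y =
    trans (within≡∂≤ 0 x y)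
          (does-⇔ (mk⇔ n≤0⇒n≡0 (λ ∂≡0 → subst (_≤ 0) (sym ∂≡0) z≤n)) (∂ x y ≤? 0) (∂ x y ≟ℕ 0))
  isDist≡∂≟ (suc i) x y =
    trans (cong₂ (λ a b → a ∧ not b) (within≡∂≤ (suc i) x y) (within≡∂≤ i x y))
          (does-⇔ ≤suc∧≰⇔≡suc (∂ x y ≤? suc i ×-dec ¬? (∂ x y ≤? i)) (∂ x y ≟ℕ suc i))

  isDist⇒∂≡ : ∀ {i} x y → isDist Γ x y i ≡ true → ∂ x y ≡ i
  isDist⇒∂≡ {i} x y d = does-true⇒ (∂ x y ≟ℕ i) (trans (sym (isDist≡∂≟ i x y)) d)

  isDist-∂ : ∀ x y → isDist Γ x y (∂ x y) ≡ true
  isDist-∂ x y = trans (isDist≡∂≟ (∂ x y) x y) (dec-true (∂ x y ≟ℕ ∂ x y) refl)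

  not-within≡<∂ : ∀ l x y → not (within Γ l x y) ≡ does (l <? ∂ x y)
  not-within≡<∂ l x y =
    trans (cong not (within≡∂≤ l x y)) (does-⇔ (mk⇔ ≰⇒> <⇒≱) (¬? (∂ x y ≤? l)) (l <? ∂ x y))

  0<Adj^∂ : ∀ x y → 0 < (Adj ^ ∂ x y) x y
  0<Adj^∂ x y =
    does-true⇒ (0 <? _) (trans (sym (walk≡0<Adj^ (∂ x y) x y)) (isDist⇒walk (∂ x y) x y (isDist-∂ x y)))

  l<∂⇒Adj^l≡0 : ∀ l x y → l < ∂ x y → (Adj ^ l) x y ≡ 0
  l<∂⇒Adj^l≡0 l x y l<∂ with (Adj ^ l) x y in walks
  ... | zero  = refl
  ... | suc _ = ⊥-elim (<⇒≱ l<∂ (does-true⇒ (∂ x y ≤? l) (trans (sym (within≡∂≤ l x y)) within-l)))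
    where
    within-l : within Γ l x y ≡ true
    within-l = walk⇒within l x y (trans (walk≡0<Adj^ l x y) (cong (λ m → does (0 <? m)) walks))

module FromIntersectionNumbers (Γ : Digraph) (D : ℕ) (simple : Simple Γ)
                               (reach : ∀ x y → within Γ D x y ≡ true)
                               (numbers : IntersectionNumbersWellDefined Γ D) where
  open Walks Γ
  open Distance Γ D reach
  open RadialMatrices D ∂ ∂≤D

  𝔸≡χ-isDist : ∀ i x y → 𝔸 i x y ≡ χ (isDist Γ x y i)
  𝔸≡χ-isDist i x y = cong χ (sym (isDist≡∂≟ i x y))

  𝔸₀≡𝟙 : ∀ x y → 𝔸 0 x y ≡ 𝟙 x y
  𝔸₀≡𝟙 x y = trans (𝔸≡χ-isDist 0 x y) (cong χ (isYes≗does (x ≟ y)))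

  radial-𝔸·ᵀAdj : ∀ (m : Fin (suc D)) → Radial (𝔸 (toℕ m) ·ᵀ Adj)
  radial-𝔸·ᵀAdj m = (λ h → proj₁ numbers h (toℕ m)) , λ x y →
    trans (sym (spheres x y))
          (proj₂ numbers (∂ x y) (toℕ m) (∂≤D x y) (toℕ≤pred[n] m) x y (isDist-∂ x y))
    where
    spheres : ∀ x y → count Γ (λ z → outSph Γ (toℕ m) x z ∧ outSph Γ 1 y z) ≡ (𝔸 (toℕ m) ·ᵀ Adj) x y
    spheres x y = trans (count-∧ Γ (outSph Γ (toℕ m) x) (outSph Γ 1 y)) (sum-cong-≗ λ z →
      cong₂ _*_ (sym (𝔸≡χ-isDist (toℕ m) x z)) (cong χ (isDist-1≡arc simple y z)))

  radial-^ᵀ : ∀ l → Radial (λ x y → (Adj ^ l) y x)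
  radial-^ᵀ l = radial-cong reversed (radial-·ᵀ^ Adj radial-𝔸·ᵀAdj (radial-𝔸 0) l)
    where
    reversed : ∀ x y → (Adj ^ l) y x ≡ (𝔸 0 ·ᵀ (Adj ^ l)) x y
    reversed x y = sym (trans (sum-cong-≗ (λ z → cong (_* (Adj ^ l) y z) (𝔸₀≡𝟙 x z)))
                              (·ᵀ-identityˡ (Adj ^ l) x y))

  radial-walkᵀ : ∀ l → Radial (λ x y → walk Γ l y x)
  radial-walkᵀ l =
    radial-cong (λ x y → walk≡0<Adj^ l y x) (radial-map (λ m → does (0 <? m)) (radial-^ᵀ l))

  radial-withinᵀ : ∀ l → Radial (λ x y → within Γ l y x)
  radial-withinᵀ zero    = radial-walkᵀ 0
  radial-withinᵀ (suc l) = radial-zipWith _∨_ (radial-withinᵀ l) (radial-walkᵀ (suc l))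

  radial-∂ᵀ : Radial (λ x y → ∂ y x)
  radial-∂ᵀ = radial-cong counting (radial-∑ {D} (λ l x y → χ (not (within Γ (toℕ l) y x)))
                                               (λ l → radial-map (χ ∘ not) (radial-withinᵀ (toℕ l))))
    where
    counting : ∀ x y → ∂ y x ≡ ∑[ l < D ] χ (not (within Γ (toℕ l) y x))
    counting x y = trans (sym (∑-χ-< {D} (∂ y x) (∂≤D y x)))
                         (sum-cong-≗ {D} (λ l → cong χ (sym (not-within≡<∂ (toℕ l) y x))))

  radial-^ : ∀ l → Radial (Adj ^ l)
  radial-^ l = radial-transpose radial-∂ᵀ (radial-^ᵀ l)

  radial-𝔸·ᵀ𝔸 : ∀ j m → m ≤ D → Radial (𝔸 j ·ᵀ 𝔸 m)
  radial-𝔸·ᵀ𝔸 j = TriangularBasis.radial-F·ᵀ𝔸 (Adj ^_) radial-^ l<∂⇒Adj^l≡0 0<Adj^∂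
                    (𝔸 j) (radial-·ᵀ^ Adj radial-𝔸·ᵀAdj (radial-𝔸 j))

  radial-inSph∩outSph : ∀ j → Radial (λ x y → count Γ (λ z → inSph Γ 1 y z ∧ outSph Γ j x z))
  radial-inSph∩outSph j = radial-cong arcs (radial-·ᵀʳ (𝔸 j) (radial-transpose radial-∂ᵀ (radial-𝔸 1))
                                                    (λ m → radial-𝔸·ᵀ𝔸 j (toℕ m) (toℕ≤pred[n] m)))
    where
    arcs : ∀ x y → count Γ (λ z → inSph Γ 1 y z ∧ outSph Γ j x z) ≡ (𝔸 j ·ᵀ (λ y z → 𝔸 1 z y)) x y
    arcs x y = trans (count-∧ Γ (inSph Γ 1 y) (outSph Γ j x)) (sum-cong-≗ λ z →
      trans (*-comm (χ (isDist Γ z y 1)) _) (sym (cong₂ _*_ (𝔸≡χ-isDist j x z) (𝔸≡χ-isDist 1 z y))))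

distanceRegular⇒intersectionNumbers : ∀ Γ D → DistanceRegular Γ D →
                                      IntersectionNumbersWellDefined Γ D
distanceRegular⇒intersectionNumbers Γ D (d→ , _ , d) = d→ , λ h i h≤D i≤D x y y∈Γₕx →
  trans (count-∧-comm Γ (outSph Γ i x) (outSph Γ 1 y)) (proj₁ (d h i h≤D i≤D x y y∈Γₕx))

intersectionNumbers⇒distanceRegular : ∀ Γ D → Simple Γ → (∀ x y → within Γ D x y ≡ true) →
                                      IntersectionNumbersWellDefined Γ D → DistanceRegular Γ D
intersectionNumbers⇒distanceRegular Γ D simple reach (s , hs) =
  s , (λ i j → proj₁ (radial-inSph∩outSph j) i) , λ i j i≤D j≤D x y y∈Γᵢx →
    trans (count-∧-comm Γ (outSph Γ 1 y) (outSph Γ j x)) (hs i j i≤D j≤D x y y∈Γᵢx) ,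
    trans (proj₂ (radial-inSph∩outSph j) x y)
          (cong (proj₁ (radial-inSph∩outSph j)) (isDist⇒∂≡ {i} x y y∈Γᵢx))
  where
  open Distance Γ D reach
  open FromIntersectionNumbers Γ D simple reach (s , hs)

theorem10p1 : (Γ : Digraph) (D : ℕ) → Simple Γ → StronglyConnected Γ → Diameter Γ D →
    ((DistanceRegular Γ D → IntersectionNumbersWellDefined Γ D)
     × (IntersectionNumbersWellDefined Γ D → DistanceRegular Γ D))
-- Strong connectivity is implied by the diameter bound, which is all that is used.
theorem10p1 Γ D simple _ (reach , _) =
  distanceRegular⇒intersectionNumbers Γ D , intersectionNumbers⇒distanceRegular Γ D simple reach
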